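{- Let $G$ be a graph, let $\mathcal{F}$ be a set of cycles, and let $Y\subseteq V(G)$ be such that the induced subgraph $G[Y]$ contains no $\mathcal{F}$-graph and, for each connected component $H$ of $G-Y$, at most one edge of $G$ joins a vertex of $H$ to a vertex of $Y$. Then $\iota(G,\mathcal{F})\le \iota(G-Y,\mathcal{F})$, and every $\mathcal{F}$-isolating set of $G-Y$ is an $\mathcal{F}$-isolating set of $G$.
   Context: All graphs are finite and simple. For $D\subseteq V(G)$, $N[D]$ is the closed neighbourhood of $D$. For a set $\mathcal{F}$ of graphs, an $\mathcal{F}$-graph is a graph isomorphic to a member of $\mathcal{F}$; $D\subseteq V(G)$ is an $\mathcal{F}$-isolating set of $G$ if $G-N[D]$ contains no $\mathcal{F}$-graph as a subgraph (equivalently, $N[D]$ intersects the vertex set of every $\mathcal{F}$-graph contained in $G$), and $\iota(G,\mathcal{F})$ is the minimum size of an $\mathcal{F}$-isolating set of $G$. $G-Y$ is the subgraph induced by $V(G)\setminus Y$. -}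

module Defs where

open import Data.Nat using (ℕ; zero; suc; _+_; _≤_)
open import Data.Nat.Base using (_≡ᵇ_)
open import Data.Bool using (Bool; true; false; _∨_; if_then_else_)
open import Data.Fin using (Fin; zero; suc; toℕ)
open import Data.Fin.Subset using (Subset; inside; outside; _∈_; _∉_; ∁; ∣_∣)
open import Data.Vec using (Vec; []; _∷_)
open import Data.Product using (Σ; Σ-syntax; ∃; ∃-syntax; _×_; _,_)
open import Data.Sum using (_⊎_)
open import Relation.Binary.PropositionalEquality using (_≡_)
open import Relation.Nullary using (¬_)
open import Function.Bundles using (_↔_; Inverse)
open import Function.Definitions using (Injective)
open import Relation.Binary.Construct.Closure.ReflexiveTransitive using (Star)

record Graph (n : ℕ) : Set where
  field
    adj     : Fin n → Fin n → Bool
    adj-sym : ∀ i j → adj i j ≡ adj j i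
    adj-irr : ∀ i → adj i i ≡ false
open Graph public

Edge : ∀ {n} → Graph n → Fin n → Fin n → Set
Edge G i j = adj G i j ≡ true

card : ∀ {n} → Subset n → ℕ
card []            = zero
card (true  ∷ S)   = suc (card S)
card (false ∷ S)   = card S

-- the i-th vertex of S, as a vertex of the ambient graph
keep : ∀ {n} (S : Subset n) → Fin (card S) → Fin n
keep (true  ∷ S) zero    = zero
keep (true  ∷ S) (suc i) = suc (keep S i)
keep (false ∷ S) i       = suc (keep S i)

lift : ∀ {n} (S : Subset n) → Subset (card S) → Subset n
lift []          []      = []
lift (true  ∷ S) (b ∷ D) = b ∷ lift S D
lift (false ∷ S) D       = outside ∷ lift S D

_[_] : ∀ {n} → Graph n → (S : Subset n) → Graph (card S)
adj     (G [ S ]) i j = adj G (keep S i) (keep S j)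
adj-sym (G [ S ]) i j = adj-sym G (keep S i) (keep S j)
adj-irr (G [ S ]) i   = adj-irr G (keep S i)

_-_ : ∀ {n} → Graph n → (Y : Subset n) → Graph (card (∁ Y))
G - Y = G [ ∁ Y ]

Family : Set₁
Family = (m : ℕ) → Graph m → Set

-- f is an embedding of H into G as a (not necessarily induced) subgraph,
-- i.e. its image is a subgraph of G isomorphic to H.
IsSubgraphEmbedding : ∀ {m n} → Graph m → Graph n → (Fin m → Fin n) → Set
IsSubgraphEmbedding H G f =
  Injective _≡_ _≡_ f × (∀ i j → Edge H i j → Edge G (f i) (f j))

ContainsF : ∀ {n} → Graph n → Family → Set
ContainsF {n} G ℱ =
  Σ[ m ∈ ℕ ] Σ[ H ∈ Graph m ] ℱ m H × Σ[ f ∈ (Fin m → Fin n) ] IsSubgraphEmbedding H G f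

-- cycles: the cycle C_m on Fin m, i adjacent to i+1 (mod m)
nextℕ : ℕ → ℕ → ℕ
nextℕ m k = if (suc k ≡ᵇ m) then zero else suc k

cycleAdj : (m : ℕ) → Fin m → Fin m → Bool
cycleAdj m i j = (nextℕ m (toℕ i) ≡ᵇ toℕ j) ∨ (nextℕ m (toℕ j) ≡ᵇ toℕ i)

IsCycle : ∀ {m} → Graph m → Set
IsCycle {m} H = 3 ≤ m × Σ[ σ ∈ (Fin m ↔ Fin m) ]
  (∀ i j → adj H (Inverse.to σ i) (Inverse.to σ j) ≡ cycleAdj m i j)

SetOfCycles : Family → Set
SetOfCycles ℱ = ∀ m (H : Graph m) → ℱ m H → IsCycle H

InN : ∀ {n} (G : Graph n) → Subset n → Fin n → Set
InN G D v = Σ[ u ∈ Fin _ ] u ∈ D × (u ≡ v ⊎ Edge G u v)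

IsIsolating : ∀ {n} → Graph n → Family → Subset n → Set
IsIsolating {n} G ℱ D =
  ∀ m (H : Graph m) → ℱ m H → (f : Fin m → Fin n) → IsSubgraphEmbedding H G f →
  Σ[ i ∈ Fin m ] InN G D (f i)

IsIota : ∀ {n} → Graph n → Family → ℕ → Set
IsIota G ℱ k =
  (Σ[ D ∈ Subset _ ] IsIsolating G ℱ D × ∣ D ∣ ≡ k) ×
  (∀ D → IsIsolating G ℱ D → k ≤ ∣ D ∣)

Connected : ∀ {n} → Graph n → Fin n → Fin n → Set
Connected G = Star (Edge G)

{-# OPTIONS --safe #-}
-- Walk around a cycle C of G that meets both Y and its complement. It enters some
-- component K of G - Y along an edge y a with y ∈ Y, and later leaves K along an edge
-- b y' with y' ∈ Y. By hypothesis a = b and y = y', so if these edges are crossed at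
-- steps c → c + 1 and e → e + 1 of the cycle, then c + 1 ≡ e and c ≡ e + 1 modulo the
-- length of C, which forces that length to divide 2. Hence every ℱ-cycle of G lies in
-- G[Y], which has none, or in G - Y, where it is isolated by any ℱ-isolating set of
-- G - Y; such a set keeps its size when viewed in G.
module Submission where

open import Defs
open import Data.Bool using (T; true; false)
open import Data.Bool.Properties using (T-≡; T-∨)
open import Data.Empty using (⊥; ⊥-elim)
open import Data.Fin using (Fin; zero; suc; toℕ; fromℕ<)
open import Data.Fin.Properties using (toℕ-injective; toℕ-fromℕ<; fromℕ<-cong; toℕ<n; all?; ¬∀⟶∃¬)
open import Data.Fin.Subset using (Subset; _∈_; ∁; ∣_∣)
open import Data.Fin.Subset.Properties using (_∈?_; x∈∁p⇒x∉p; x∉p⇒x∈∁p)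
open import Data.Nat using (ℕ; suc; _+_; _*_; _≤_; _<_; s≤s; z≤n; NonZero; _≡ᵇ_; _≤‴_; ≤‴-refl; ≤‴-step)
open import Data.Nat.Properties using (≤∧≢⇒<; ≡ᵇ⇒≡; ≡⇒≡ᵇ; +-assoc; +-comm; +-cancelʳ-≡; ≤-trans; m≤m*n; m≤n+m; m<m+n; ≤⇒≤‴)
open import Data.Nat.DivMod using (_%_; _/_; m%n<n; m<n⇒m%n≡m; n%n≡0; m%n%n≡m%n; %-distribˡ-+; [m+n]%n≡m%n; [m+kn]%n≡m%n; m≡m%n+[m/n]*n)
open import Data.Nat.Divisibility using (_∣_; divides; >⇒∤)
open import Data.Product using (Σ-syntax; _×_; _,_; proj₁; proj₂)
open import Data.Sum using (inj₁)
import Data.Sum as Sum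
open import Data.Unit using (tt)
open import Data.Vec using ([]; _∷_)
open import Data.Vec.Base using (here; there)
open import Function using (id)
open import Function.Bundles using (_↔_; Inverse; Equivalence)
open import Relation.Binary.Construct.Closure.ReflexiveTransitive using (ε; _◅_)
open import Relation.Binary.PropositionalEquality using (_≡_; refl; sym; trans; cong; subst; subst₂; module ≡-Reasoning)
open import Relation.Nullary using (¬_; yes; no)

open Inverse using (to; from; strictlyInverseˡ; strictlyInverseʳ)

unkeep : ∀ {n} (S : Subset n) {v} → v ∈ S → Fin (card S)
unkeep (true  ∷ S) here        = zero
unkeep (true  ∷ S) (there v∈S) = suc (unkeep S v∈S)
unkeep (false ∷ S) (there v∈S) = unkeep S v∈S

keep-unkeep : ∀ {n} (S : Subset n) {v} (v∈S : v ∈ S) → keep S (unkeep S v∈S) ≡ v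
keep-unkeep (true  ∷ S) here        = refl
keep-unkeep (true  ∷ S) (there v∈S) = cong suc (keep-unkeep S v∈S)
keep-unkeep (false ∷ S) (there v∈S) = cong suc (keep-unkeep S v∈S)

unkeep-injective : ∀ {n} (S : Subset n) {u v} (u∈S : u ∈ S) (v∈S : v ∈ S) →
  unkeep S u∈S ≡ unkeep S v∈S → u ≡ v
unkeep-injective S {u} {v} u∈S v∈S eq = begin
  u                    ≡⟨ keep-unkeep S u∈S ⟨
  keep S (unkeep S u∈S) ≡⟨ cong (keep S) eq ⟩
  keep S (unkeep S v∈S) ≡⟨ keep-unkeep S v∈S ⟩
  v                    ∎
  where open ≡-Reasoning

keep∈lift : ∀ {n} (S : Subset n) {D} {u} → u ∈ D → keep S u ∈ lift S D
keep∈lift (true  ∷ S) here        = here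
keep∈lift (true  ∷ S) (there u∈D) = there (keep∈lift S u∈D)
keep∈lift (false ∷ S) u∈D         = there (keep∈lift S u∈D)

∣lift∣≡∣∣ : ∀ {n} (S : Subset n) (D : Subset (card S)) → ∣ lift S D ∣ ≡ ∣ D ∣
∣lift∣≡∣∣ []          []          = refl
∣lift∣≡∣∣ (true  ∷ S) (true  ∷ D) = cong suc (∣lift∣≡∣∣ S D)
∣lift∣≡∣∣ (true  ∷ S) (false ∷ D) = ∣lift∣≡∣∣ S D
∣lift∣≡∣∣ (false ∷ S) D           = ∣lift∣≡∣∣ S D

edge-sym : ∀ {n} (G : Graph n) {u v} → Edge G u v → Edge G v u
edge-sym G {u} {v} e = trans (adj-sym G v u) e

edge-unkeep : ∀ {n} (G : Graph n) (S : Subset n) {u v} (u∈S : u ∈ S) (v∈S : v ∈ S) →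
  Edge G u v → Edge (G [ S ]) (unkeep S u∈S) (unkeep S v∈S)
edge-unkeep G S u∈S v∈S = subst₂ (Edge G) (sym (keep-unkeep S u∈S)) (sym (keep-unkeep S v∈S))

embedding-into-induced : ∀ {m n} {H : Graph m} (G : Graph n) (S : Subset n) {f : Fin m → Fin n}
  (f∈S : ∀ i → f i ∈ S) → IsSubgraphEmbedding H G f →
  IsSubgraphEmbedding H (G [ S ]) (λ i → unkeep S (f∈S i))
embedding-into-induced G S f∈S (f-injective , f-edge) =
  (λ {i} {j} eq → f-injective (unkeep-injective S (f∈S i) (f∈S j) eq)) ,
  (λ i j e → edge-unkeep G S (f∈S i) (f∈S j) (f-edge i j e))

InN-lift : ∀ {n} (G : Graph n) (S : Subset n) {D v} →
  InN (G [ S ]) D v → InN G (lift S D) (keep S v)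
InN-lift G S (u , u∈D , u≡v⊎uv) = keep S u , keep∈lift S u∈D , Sum.map (cong (keep S)) id u≡v⊎uv

module _ {d : ℕ} .{{_ : NonZero d}} where

  %-cong-+ˡ : ∀ k {m n} → m % d ≡ n % d → (k + m) % d ≡ (k + n) % d
  %-cong-+ˡ k {m} {n} eq = begin
    (k + m) % d             ≡⟨ %-distribˡ-+ k m d ⟩
    (k % d + m % d) % d     ≡⟨ cong (λ r → (k % d + r) % d) eq ⟩
    (k % d + n % d) % d     ≡⟨ %-distribˡ-+ k n d ⟨
    (k + n) % d             ∎
    where open ≡-Reasoning

  [k+m]%d≡m%d⇒d∣k : ∀ k m → (k + m) % d ≡ m % d → d ∣ k
  [k+m]%d≡m%d⇒d∣k k m eq = divides q (+-cancelʳ-≡ r k _ k+r≡q*d+r)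
    where
    open ≡-Reasoning
    r = m % d
    q = (k + r) / d
    [k+r]%d≡r : (k + r) % d ≡ r
    [k+r]%d≡r = begin
      (k + r) % d               ≡⟨ [m+kn]%n≡m%n (k + r) (m / d) d ⟨
      (k + r + m / d * d) % d   ≡⟨ cong (_% d) (+-assoc k r _) ⟩
      (k + (r + m / d * d)) % d ≡⟨ cong (λ x → (k + x) % d) (m≡m%n+[m/n]*n m d) ⟨
      (k + m) % d               ≡⟨ eq ⟩
      r                         ∎
    k+r≡q*d+r : k + r ≡ q * d + r
    k+r≡q*d+r = begin
      k + r               ≡⟨ m≡m%n+[m/n]*n (k + r) d ⟩
      (k + r) % d + q * d ≡⟨ cong (_+ q * d) [k+r]%d≡r ⟩
      r + q * d           ≡⟨ +-comm r _ ⟩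
      q * d + r           ∎

  nextℕ≡suc% : ∀ {r} → r < d → nextℕ d r ≡ suc r % d
  nextℕ≡suc% {r} r<d with suc r ≡ᵇ d in eq
  ... | true  = trans (sym (n%n≡0 d)) (cong (_% d) (sym (≡ᵇ⇒≡ (suc r) d (subst T (sym eq) tt))))
  ... | false = sym (m<n⇒m%n≡m (≤∧≢⇒< r<d (λ sr≡d → subst T eq (≡⇒≡ᵇ (suc r) d sr≡d))))

IsWalk : ∀ {n} → Graph n → (ℕ → Fin n) → Set
IsWalk G w = ∀ t → Edge G (w t) (w (suc t))

record IsCyclicWalk {n} (G : Graph n) (M : ℕ) .{{_ : NonZero M}} (w : ℕ → Fin n) : Set where
  field
    isWalk    : IsWalk G w
    periodic  : ∀ {s t} → s % M ≡ t % M → w s ≡ w t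
    injective : ∀ {s t} → w s ≡ w t → s % M ≡ t % M

cycleAdj-next : ∀ {m} (i j : Fin m) → nextℕ m (toℕ i) ≡ toℕ j → cycleAdj m i j ≡ true
cycleAdj-next i j next≡j =
  Equivalence.to T-≡ (Equivalence.from T-∨ (inj₁ (≡⇒≡ᵇ _ _ next≡j)))

module CycleWalk {m n} .{{_ : NonZero m}} {H : Graph m} {G : Graph n} (σ : Fin m ↔ Fin m)
  (σ-cycle : ∀ i j → adj H (to σ i) (to σ j) ≡ cycleAdj m i j)
  {f : Fin m → Fin n} (emb : IsSubgraphEmbedding H G f) where

  position : ℕ → Fin m
  position t = fromℕ< (m%n<n t m)

  walk : ℕ → Fin n
  walk t = f (to σ (position t))

  toℕ-position : ∀ t → toℕ (position t) ≡ t % m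
  toℕ-position t = toℕ-fromℕ< (m%n<n t m)

  next-position : ∀ t → nextℕ m (toℕ (position t)) ≡ toℕ (position (suc t))
  next-position t = begin
    nextℕ m (toℕ (position t)) ≡⟨ cong (nextℕ m) (toℕ-position t) ⟩
    nextℕ m (t % m)            ≡⟨ nextℕ≡suc% (m%n<n t m) ⟩
    (1 + t % m) % m            ≡⟨ %-cong-+ˡ 1 (m%n%n≡m%n t m) ⟩
    (1 + t) % m                ≡⟨ toℕ-position (suc t) ⟨
    toℕ (position (suc t))     ∎
    where open ≡-Reasoning

  isCyclicWalk : IsCyclicWalk G m walk
  isCyclicWalk = record
    { isWalk    = λ t → proj₂ emb _ _
        (trans (σ-cycle _ _) (cycleAdj-next (position t) (position (suc t)) (next-position t)))
    ; periodic  = λ {s} {t} s≡t → cong (λ i → f (to σ i)) (fromℕ<-cong _ _ s≡t _ _)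
    ; injective = λ {s} {t} ws≡wt → begin
        s % m                           ≡⟨ toℕ-position s ⟨
        toℕ (position s)                ≡⟨ cong toℕ (to-injective (proj₁ emb ws≡wt)) ⟩
        toℕ (position t)                ≡⟨ toℕ-position t ⟩
        t % m                           ∎
    }
    where
    open ≡-Reasoning
    to-injective : ∀ {i j} → to σ i ≡ to σ j → i ≡ j
    to-injective {i} {j} eq = trans (sym (strictlyInverseʳ σ i))
                                    (trans (cong (from σ) eq) (strictlyInverseʳ σ j))

  walk-visits : ∀ i → walk (toℕ (from σ i)) ≡ f i
  walk-visits i = cong f (trans (cong (to σ) position≡from) (strictlyInverseˡ σ i))
    where
    position≡from : position (toℕ (from σ i)) ≡ from σ i
    position≡from = toℕ-injective
      (trans (toℕ-position _) (m<n⇒m%n≡m (toℕ<n (from σ i))))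

module Crossing {n} (G : Graph n) (Y : Subset n) {w : ℕ → Fin n} (isWalk : IsWalk G w) where

  enter-∁ : ∀ {a b} → a ≤‴ b → w a ∈ Y → w b ∈ ∁ Y → Σ[ c ∈ ℕ ] w c ∈ Y × w (suc c) ∈ ∁ Y
  enter-∁ ≤‴-refl a∈Y a∈∁Y = ⊥-elim (x∈∁p⇒x∉p a∈∁Y a∈Y)
  enter-∁ {a} (≤‴-step a<b) a∈Y b∈∁Y with w (suc a) ∈? Y
  ... | yes sa∈Y = enter-∁ a<b sa∈Y b∈∁Y
  ... | no  sa∉Y = a , a∈Y , x∉p⇒x∈∁p sa∉Y

  exit-∁ : ∀ {u b} → u ≤‴ b → (u∈∁Y : w u ∈ ∁ Y) → w b ∈ Y →
    Σ[ e ∈ ℕ ] Σ[ e∈∁Y ∈ w e ∈ ∁ Y ]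
      w (suc e) ∈ Y × Connected (G - Y) (unkeep (∁ Y) u∈∁Y) (unkeep (∁ Y) e∈∁Y)
  exit-∁ ≤‴-refl u∈∁Y u∈Y = ⊥-elim (x∈∁p⇒x∉p u∈∁Y u∈Y)
  exit-∁ {u} (≤‴-step u<b) u∈∁Y b∈Y with w (suc u) ∈? Y
  ... | yes su∈Y = u , u∈∁Y , su∈Y , ε
  ... | no  su∉Y =
    let su∈∁Y = x∉p⇒x∈∁p su∉Y
        (e , e∈∁Y , se∈Y , path) = exit-∁ u<b su∈∁Y b∈Y
    in  e , e∈∁Y , se∈Y , edge-unkeep G (∁ Y) u∈∁Y su∈∁Y (isWalk u) ◅ path

AtMostOneEdgeToY : ∀ {n} → Graph n → Subset n → Set
AtMostOneEdgeToY {n} G Y =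
  ∀ (a b : Fin (card (∁ Y))) (y₁ y₂ : Fin n) → y₁ ∈ Y → y₂ ∈ Y →
  Connected (G - Y) a b →
  Edge G (keep (∁ Y) a) y₁ → Edge G (keep (∁ Y) b) y₂ →
  a ≡ b × y₁ ≡ y₂

module _ {n} (G : Graph n) (Y : Subset n) (one-edge : AtMostOneEdgeToY G Y) where

  same-edge-to-Y : ∀ {u v y₁ y₂} (u∈∁Y : u ∈ ∁ Y) (v∈∁Y : v ∈ ∁ Y) →
    Connected (G - Y) (unkeep (∁ Y) u∈∁Y) (unkeep (∁ Y) v∈∁Y) → y₁ ∈ Y → y₂ ∈ Y →
    Edge G u y₁ → Edge G v y₂ → u ≡ v × y₁ ≡ y₂
  same-edge-to-Y {y₁ = y₁} {y₂} u∈∁Y v∈∁Y path y₁∈Y y₂∈Y uy₁ vy₂ =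
    let (u≡v , y₁≡y₂) = one-edge _ _ y₁ y₂ y₁∈Y y₂∈Y path
          (subst (λ x → Edge G x y₁) (sym (keep-unkeep (∁ Y) u∈∁Y)) uy₁)
          (subst (λ x → Edge G x y₂) (sym (keep-unkeep (∁ Y) v∈∁Y)) vy₂)
    in  unkeep-injective (∁ Y) u∈∁Y v∈∁Y u≡v , y₁≡y₂

  cyclicWalk-not-split : ∀ {M} .{{_ : NonZero M}} {w} → 3 ≤ M → IsCyclicWalk G M w →
    ∀ p q → w p ∈ Y → w q ∈ ∁ Y → ⊥
  cyclicWalk-not-split {M} 3≤M cw p q p∈Y q∈∁Y =
    -- q + p * M and c + M are later visits of the vertices w q and w c.
    let (c , c∈Y , sc∈∁Y) = enter-∁ (≤⇒≤‴ (≤-trans (m≤m*n p M) (m≤n+m (p * M) q))) p∈Y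
                              (subst (_∈ ∁ Y) (periodic (sym ([m+kn]%n≡m%n q p M))) q∈∁Y)
        (e , e∈∁Y , se∈Y , path) = exit-∁ (≤⇒≤‴ (m<m+n c (≤-trans (s≤s z≤n) 3≤M))) sc∈∁Y
                                     (subst (_∈ Y) (periodic (sym ([m+n]%n≡m%n c M))) c∈Y)
        (sc≡e , c≡se) = same-edge-to-Y sc∈∁Y e∈∁Y path c∈Y se∈Y (edge-sym G (isWalk c)) (isWalk e)
    in  >⇒∤ 3≤M ([k+m]%d≡m%d⇒d∣k 2 c (begin
          (1 + suc c) % M ≡⟨ %-cong-+ˡ 1 (injective sc≡e) ⟩
          (1 + e) % M     ≡⟨ injective c≡se ⟨
          c % M           ∎))
    where
    open IsCyclicWalk cw
    open Crossing G Y isWalk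
    open ≡-Reasoning

  cycle-not-split : ∀ {m} {H : Graph m} {f : Fin m → Fin n} {p q} → IsCycle H →
    IsSubgraphEmbedding H G f → f p ∈ Y → f q ∈ ∁ Y → ⊥
  -- Matching 3≤m against s≤s exposes m = suc _, which supplies the NonZero m instance.
  cycle-not-split {H = H} {f} {p} {q} (3≤m@(s≤s _) , σ , σ-cycle) emb p∈Y q∈∁Y =
    cyclicWalk-not-split 3≤m isCyclicWalk (toℕ (from σ p)) (toℕ (from σ q))
      (subst (_∈ Y) (sym (walk-visits p)) p∈Y) (subst (_∈ ∁ Y) (sym (walk-visits q)) q∈∁Y)
    where open CycleWalk {H = H} {G} σ σ-cycle {f} emb

  isolating-lift : ∀ {ℱ} {D} → SetOfCycles ℱ → ¬ ContainsF (G [ Y ]) ℱ →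
    IsIsolating (G - Y) ℱ D → IsIsolating G ℱ (lift (∁ Y) D)
  isolating-lift cycles Y-free D-isolating m H H∈ℱ f emb with all? (λ i → f i ∈? Y)
  ... | yes f∈Y  = ⊥-elim (Y-free (m , H , H∈ℱ , _ , embedding-into-induced {H = H} G Y f∈Y emb))
  ... | no  f∉Y =
    let (q , fq∉Y) = ¬∀⟶∃¬ m _ (λ i → f i ∈? Y) f∉Y
        f∈∁Y : ∀ i → f i ∈ ∁ Y
        f∈∁Y i = x∉p⇒x∈∁p λ fi∈Y →
          cycle-not-split {H = H} {f} (cycles m H H∈ℱ) emb fi∈Y (x∉p⇒x∈∁p fq∉Y)
        (i , i-dominated) = D-isolating m H H∈ℱ _ (embedding-into-induced {H = H} G (∁ Y) f∈∁Y emb)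
    in  i , subst (InN G _) (keep-unkeep (∁ Y) (f∈∁Y i)) (InN-lift G (∁ Y) i-dominated)

lemma2p6 : ∀ {n} (G : Graph n) (ℱ : Family) (Y : Subset n) →
    SetOfCycles ℱ →
    ¬ ContainsF (G [ Y ]) ℱ →
    (∀ (a b : Fin (card (∁ Y))) (y₁ y₂ : Fin n) → y₁ ∈ Y → y₂ ∈ Y →
    Connected (G - Y) a b →
    Edge G (keep (∁ Y) a) y₁ → Edge G (keep (∁ Y) b) y₂ →
    a ≡ b × y₁ ≡ y₂) →
    (∀ (k l : ℕ) → IsIota G ℱ k → IsIota (G - Y) ℱ l → k ≤ l) ×
    (∀ (D : Subset (card (∁ Y))) → IsIsolating (G - Y) ℱ D →
    IsIsolating G ℱ (lift (∁ Y) D))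
lemma2p6 G ℱ Y cycles Y-free one-edge = ι-mono , λ D → lift-isolating
  where
  lift-isolating : ∀ {D} → IsIsolating (G - Y) ℱ D → IsIsolating G ℱ (lift (∁ Y) D)
  lift-isolating = isolating-lift G Y one-edge cycles Y-free

  ι-mono : ∀ k l → IsIota G ℱ k → IsIota (G - Y) ℱ l → k ≤ l
  ι-mono k l (_ , G-minimal) ((D , D-isolating , ∣D∣≡l) , _) =
    subst (k ≤_) (trans (∣lift∣≡∣∣ (∁ Y) D) ∣D∣≡l) (G-minimal _ (lift-isolating D-isolating))
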